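{- Let $G$ be a finite group of order $v$ (written additively, not necessarily abelian) and let $A$ be a non-trivial group of automorphisms of $G$ of order $k$ such that $(G,A)$ is a Ferrero pair. Then the set of $A$-orbits on $G\setminus\{0\}$ is a disjoint $(v,k,k-1)$ difference family in $G$. If moreover $G$ is abelian and $vk$ is odd, this difference family can be partitioned into two disjoint $(v,k,\frac{k-1}{2})$ difference families.
   Context: Groups are finite and written additively but not necessarily abelian. For a subset $B$ of a group $G$, the list of differences $\Delta B$ is the multiset of all differences $b-b'$ with $b,b'\in B$, $b\neq b'$. A collection $\mathcal F$ of subsets of $G$ is a difference family of index $\lambda$ if the multiset union $\biguplus_{B\in\mathcal F}\Delta B$ covers every non-zero element of $G$ exactly $\lambda$ times; it is a $(v,k,\lambda)$ difference family if $|G|=v$ and all members (blocks) have size $k$. It is disjoint (a DDF) if its blocks are pairwise disjoint. A Ferrero pair is a pair $(G,A)$ where $A$ is a non-trivial group of automorphisms of $G$ acting semiregularly on $G\setminus\{0\}$, i.e. for $g\in G$ and $\alpha\in A$, $\alpha(g)=g$ holds only if $\alpha=\mathrm{id}_G$ or $g=0$. -}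

module Defs where

open import Data.Nat using (ℕ; _≤_)
open import Data.Fin using (Fin)
open import Data.Fin.Properties using () renaming (_≟_ to _≟ᶠ_)
open import Data.Fin.Subset using (Subset; _∩_; ⊥; ∣_∣; _∈_)
open import Data.Fin.Subset.Properties using (_∈?_)
open import Data.Bool using (Bool)
open import Data.Bool.Properties using () renaming (_≟_ to _≟ᵇ_)
open import Data.Vec using (tabulate)
open import Data.Vec.Properties using (≡-dec)
open import Data.Nat.ListAction using (sum)
open import Data.List using (List; filter; length; map; allFin; cartesianProduct; deduplicate)
open import Data.List.Relation.Unary.All using (All)
open import Data.List.Relation.Unary.AllPairs using (AllPairs)
open import Data.Product using (Σ; ∃; _×_; _,_; proj₁; proj₂)
open import Data.Sum using (_⊎_)
open import Relation.Nullary using (¬_; does; Dec)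
open import Relation.Nullary.Decidable using (_×-dec_; ¬?)
open import Relation.Binary.PropositionalEquality using (_≡_)
open import Function.Definitions using (Bijective)
open import Data.Fin.Properties using (any?)

-- A finite group of order v, written additively (not necessarily abelian).
-- Every finite group of order v is isomorphic to one with carrier Fin v.
record FinGroup (v : ℕ) : Set where
  field
    _+_     : Fin v → Fin v → Fin v
    0#      : Fin v
    -_      : Fin v → Fin v
    +-assoc : ∀ x y z → (x + y) + z ≡ x + (y + z)
    +-idˡ   : ∀ x → 0# + x ≡ x
    +-idʳ   : ∀ x → x + 0# ≡ x
    -‿invˡ  : ∀ x → (- x) + x ≡ 0#
    -‿invʳ  : ∀ x → x + (- x) ≡ 0#
  infixl 6 _+_
  infix 8 -_
  _-_ : Fin v → Fin v → Fin v
  x - y = x + (- y)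

module _ {v : ℕ} (G : FinGroup v) where
  open FinGroup G

  IsAbelian : Set
  IsAbelian = ∀ x y → x + y ≡ y + x

  IsAutomorphism : (Fin v → Fin v) → Set
  IsAutomorphism α = (∀ x y → α (x + y) ≡ α x + α y) × Bijective _≡_ _≡_ α

  -- A group A of automorphisms of G of order k, given by an enumeration
  -- α : Fin k → Aut(G) of its k (pointwise distinct) elements.
  record IsAutGroup (k : ℕ) (α : Fin k → Fin v → Fin v) : Set where
    field
      auto     : ∀ i → IsAutomorphism (α i)
      distinct : ∀ i j → (∀ g → α i g ≡ α j g) → i ≡ j
      hasId    : ∃ λ i → ∀ g → α i g ≡ g
      closed   : ∀ i j → ∃ λ l → ∀ g → α l g ≡ α i (α j g)
      hasInv   : ∀ i → ∃ λ j → ∀ g → α j (α i g) ≡ g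

  IsFerreroPair : (k : ℕ) → (Fin k → Fin v → Fin v) → Set
  IsFerreroPair k α =
    IsAutGroup k α × 2 ≤ k ×
    (∀ i g → α i g ≡ g → (∀ h → α i h ≡ h) ⊎ g ≡ 0#)

  -- number of ordered pairs (b , b') in B × B with b ≢ b' and b - b' ≡ x,
  -- i.e. the multiplicity of x in the list of differences ΔB
  ΔCount : Subset v → Fin v → ℕ
  ΔCount B x = length (filter P? (cartesianProduct (allFin v) (allFin v)))
    where
    P? : (p : Fin v × Fin v) → Dec ((proj₁ p ∈ B × proj₂ p ∈ B) × (¬ proj₁ p ≡ proj₂ p × proj₁ p - proj₂ p ≡ x))
    P? (b , b') = ((b ∈? B) ×-dec (b' ∈? B)) ×-dec (¬? (b ≟ᶠ b') ×-dec ((b - b') ≟ᶠ x))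

  IsDF : List (Subset v) → ℕ → ℕ → Set
  IsDF F k λ' = All (λ B → ∣ B ∣ ≡ k) F ×
                (∀ x → ¬ x ≡ 0# → sum (map (λ B → ΔCount B x) F) ≡ λ')

  IsDDF : List (Subset v) → ℕ → ℕ → Set
  IsDDF F k λ' = IsDF F k λ' × AllPairs (λ B C → B ∩ C ≡ ⊥) F

  orbit : {k : ℕ} → (Fin k → Fin v → Fin v) → Fin v → Subset v
  orbit α g = tabulate (λ h → does (any? (λ i → α i g ≟ᶠ h)))

  orbits : {k : ℕ} → (Fin k → Fin v → Fin v) → List (Subset v)
  orbits α = deduplicate (≡-dec _≟ᵇ_)
               (map (orbit α) (filter (λ g → ¬? (g ≟ᶠ 0#)) (allFin v)))

module Submission where

-- For x ≠ 0 call
-- - x + a the x-partner of a: it is the b with a - b = x.  A pair (a , b) of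
-- distinct elements with a - b = x lies in a common orbit iff b is the
-- x-partner of a and lies in the orbit O a, so the number of differences x
-- in the orbits, each orbit weighted by some w, is the number of a whose
-- x-partner is in O a, weighted by w (O a)  (weighted-Δ).  Such an a comes with
-- a unique α ∈ A ∖ {id} satisfying a - α a = x, and the displacement
-- a ↦ a - α a of α ≠ id is injective by semiregularity, hence bijective; so
-- there are exactly k - 1 such a  (partner-count), proving the first claim.
-- If G is abelian and v k is odd, no orbit equals its negative, so picking
-- the lexicographically smaller of O y and - O y = O (- y) splits the orbits
-- into two families; the reflection a ↦ x - a exchanges their weighted
-- partner counts, which are therefore both (k - 1) / 2.
-- The file first develops finite sums and counting over Fin n, then group
-- laws, then orbits of a Ferrero pair, and derives the two claims.

open import Defs
open import Algebra.Bundles using (Group)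
import Algebra.Properties.Group as GroupProperties
open import Data.Bool using (Bool; true; false)
open import Data.Bool.Properties as Bool using () renaming (_≟_ to _≟ᵇ_)
open import Data.Empty using (⊥-elim)
open import Data.Fin using (Fin; zero; suc) renaming (_<_ to _<ᶠ_)
open import Data.Fin.Properties using (any?; <-cmp; _<?_) renaming (_≟_ to _≟ᶠ_)
open import Data.Vec as Vec using ([]; _∷_)
open import Data.Vec.Properties using (lookup∘tabulate; []=⇒lookup; lookup⇒[]=; ≡-dec)
open import Data.Fin.Subset using (Subset; _∩_; ⊥; ∣_∣; _∈_)
open import Data.Fin.Subset.Properties using (_∈?_; ⊆-antisym; Empty-unique; x∈p∩q⁻; drop-there)
open import Data.List using (List; []; _∷_; _++_; map; filter; length; allFin; cartesianProduct)
open import Data.List.Properties using (length-tabulate; map-tabulate)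
open import Data.List.Membership.Propositional using () renaming (_∈_ to _∈ₗ_)
open import Data.List.Membership.Propositional.Properties
  using (∈-allFin; ∈-deduplicate⁻; ∈-deduplicate⁺; ∈-map⁻; ∈-map⁺; ∈-filter⁻; ∈-filter⁺)
open import Data.List.Relation.Unary.All as All using (All; []; _∷_)
open import Data.List.Relation.Unary.All.Properties as All using ()
open import Data.List.Relation.Unary.AllPairs as AllPairs using (AllPairs; []; _∷_)
import Data.List.Relation.Unary.AllPairs.Properties as AllPairs
open import Data.List.Relation.Unary.Any using (here; there)
open import Data.List.Relation.Unary.Unique.Propositional using (Unique)
open import Data.List.Relation.Unary.Unique.Propositional.Properties using (allFin⁺)
open import Data.List.Relation.Unary.Unique.DecPropositional.Properties using (deduplicate-!)
open import Data.List.Relation.Binary.Permutation.Propositional using (_↭_; prep; ↭-refl; ↭-trans; ↭-sym)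
open import Data.List.Relation.Binary.Permutation.Propositional.Properties using (shift)
open import Data.Nat using (ℕ; zero; suc; _*_; _∸_; _/_; _%_; _≤_; z≤n; s≤s)
open import Data.Nat.Properties using (*-identityˡ; *-identityʳ; *-zeroʳ; *-comm; *-assoc; *-commutativeSemigroup)
open import Algebra.Properties.CommutativeSemigroup *-commutativeSemigroup using (xy∙z≈xz∙y)
open import Data.Nat.DivMod using (m*n%n≡0; m*n/n≡m)
open import Data.Nat.ListAction using (sum)
open import Data.Nat.Tactic.RingSolver using (solve-∀)
open import Data.Product using (Σ; ∃; _×_; _,_; proj₁; proj₂)
open import Data.Sum using (_⊎_; inj₁; inj₂)
open import Relation.Binary.Bundles using (StrictTotalOrder)
open import Relation.Binary.Definitions using (Tri; tri<; tri≈; tri>)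
import Data.Vec.Relation.Binary.Lex.Strict as Lex
open import Data.Vec.Relation.Binary.Pointwise.Inductive using (Pointwise-≡⇒≡)
open import Level using (0ℓ)
open import Relation.Nullary using (¬_; Dec; yes; no; does; _because_; ¬?)
open import Relation.Nullary.Decidable using (_×-dec_; dec-true)
open import Relation.Binary.PropositionalEquality

module Counting where
  open import Data.Nat using (_+_)
  open import Data.Nat.Properties
    using (+-identityʳ; +-assoc; +-comm; +-cancelˡ-≡; +-mono-≤; +-monoʳ-≤; +-cancelʳ-≤; ≤-antisym;
           *-distribˡ-+; m+n∸n≡m; +-commutativeSemigroup)
  open import Algebra.Properties.CommutativeSemigroup +-commutativeSemigroup
    using () renaming (interchange to +-interchange)

  private variable
    A B : Set

  ind : {P : Set} → Dec P → ℕ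
  ind (true because _) = 1
  ind (false because _) = 0

  ind-yes : {P : Set} (d : Dec P) → P → ind d ≡ 1
  ind-yes (yes _) p = refl
  ind-yes (no ¬p) p = ⊥-elim (¬p p)

  ind-no : {P : Set} (d : Dec P) → ¬ P → ind d ≡ 0
  ind-no (yes p) ¬p = ⊥-elim (¬p p)
  ind-no (no _) ¬p = refl

  ind-⇔ : {P Q : Set} (d : Dec P) (e : Dec Q) → (P → Q) → (Q → P) → ind d ≡ ind e
  ind-⇔ (yes p) e f g = sym (ind-yes e (f p))
  ind-⇔ (no ¬p) e f g = sym (ind-no e (λ q → ¬p (g q)))

  ind-× : {P Q : Set} (d : Dec P) (e : Dec Q) → ind (d ×-dec e) ≡ ind d * ind e
  ind-× (yes _) (yes _) = refl
  ind-× (yes _) (no _) = refl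
  ind-× (no _) e = refl

  ind-¬ : {P : Set} (d : Dec P) → ind (¬? d) + ind d ≡ 1
  ind-¬ (yes _) = refl
  ind-¬ (no _) = refl

  ind≤1 : {P : Set} (d : Dec P) → ind d ≤ 1
  ind≤1 (yes _) = s≤s z≤n
  ind≤1 (no _) = z≤n

  ∑ : List A → (A → ℕ) → ℕ
  ∑ [] f = 0
  ∑ (x ∷ xs) f = f x + ∑ xs f

  syntax ∑ xs (λ a → e) = ∑[ a ∈ xs ] e

  sum-map : (xs : List A) (f : A → ℕ) → sum (map f xs) ≡ ∑ xs f
  sum-map [] f = refl
  sum-map (x ∷ xs) f = cong (f x +_) (sum-map xs f)

  ∑-congᵐ : (xs : List A) {f g : A → ℕ} → (∀ a → a ∈ₗ xs → f a ≡ g a) → ∑ xs f ≡ ∑ xs g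
  ∑-congᵐ [] h = refl
  ∑-congᵐ (x ∷ xs) h = cong₂ _+_ (h x (here refl)) (∑-congᵐ xs (λ a m → h a (there m)))

  ∑-cong : (xs : List A) {f g : A → ℕ} → (∀ a → f a ≡ g a) → ∑ xs f ≡ ∑ xs g
  ∑-cong xs h = ∑-congᵐ xs (λ a _ → h a)

  ∑-+ : (xs : List A) (f g : A → ℕ) → ∑[ a ∈ xs ] (f a + g a) ≡ ∑ xs f + ∑ xs g
  ∑-+ [] f g = refl
  ∑-+ (x ∷ xs) f g rewrite ∑-+ xs f g = +-interchange (f x) (g x) (∑ xs f) (∑ xs g)

  ∑-*ˡ : (xs : List A) (c : ℕ) (f : A → ℕ) → ∑[ a ∈ xs ] (c * f a) ≡ c * ∑ xs f
  ∑-*ˡ [] c f = sym (*-zeroʳ c)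
  ∑-*ˡ (x ∷ xs) c f rewrite ∑-*ˡ xs c f = sym (*-distribˡ-+ c (f x) _)

  ∑-*ʳ : (xs : List A) (c : ℕ) (f : A → ℕ) → ∑[ a ∈ xs ] (f a * c) ≡ ∑ xs f * c
  ∑-*ʳ xs c f = trans (∑-cong xs (λ a → *-comm (f a) c)) (trans (∑-*ˡ xs c f) (*-comm c _))

  ∑-zero : (xs : List A) (f : A → ℕ) → (∀ a → a ∈ₗ xs → f a ≡ 0) → ∑ xs f ≡ 0
  ∑-zero [] f h = refl
  ∑-zero (x ∷ xs) f h rewrite h x (here refl) = ∑-zero xs f (λ a m → h a (there m))

  ∑-1 : (xs : List A) → ∑[ _ ∈ xs ] 1 ≡ length xs
  ∑-1 [] = refl
  ∑-1 (x ∷ xs) = cong suc (∑-1 xs)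

  ∑-swap : (xs : List A) (ys : List B) (f : A → B → ℕ) →
    ∑[ a ∈ xs ] ∑[ b ∈ ys ] f a b ≡ ∑[ b ∈ ys ] ∑[ a ∈ xs ] f a b
  ∑-swap [] ys f = sym (∑-zero ys _ (λ _ _ → refl))
  ∑-swap (x ∷ xs) ys f rewrite ∑-swap xs ys f = sym (∑-+ ys (f x) (λ b → ∑[ a ∈ xs ] f a b))

  ∑-++ : (xs ys : List A) (f : A → ℕ) → ∑ (xs ++ ys) f ≡ ∑ xs f + ∑ ys f
  ∑-++ [] ys f = refl
  ∑-++ (x ∷ xs) ys f rewrite ∑-++ xs ys f = sym (+-assoc (f x) _ _)

  ∑-map : (xs : List A) (g : A → B) (f : B → ℕ) → ∑ (map g xs) f ≡ ∑[ a ∈ xs ] f (g a)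
  ∑-map [] g f = refl
  ∑-map (x ∷ xs) g f = cong (f (g x) +_) (∑-map xs g f)

  ∑-cartesianProduct : (xs : List A) (ys : List B) (f : A × B → ℕ) →
    ∑ (cartesianProduct xs ys) f ≡ ∑[ a ∈ xs ] ∑[ b ∈ ys ] f (a , b)
  ∑-cartesianProduct [] ys f = refl
  ∑-cartesianProduct (x ∷ xs) ys f = trans (∑-++ (map (x ,_) ys) _ f)
    (cong₂ _+_ (∑-map ys (x ,_) f) (∑-cartesianProduct xs ys f))

  ∑-filter : {P : A → Set} (P? : ∀ a → Dec (P a)) (xs : List A) (f : A → ℕ) →
    ∑ (filter P? xs) f ≡ ∑[ a ∈ xs ] (ind (P? a) * f a)
  ∑-filter P? [] f = refl
  ∑-filter P? (x ∷ xs) f with P? x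
  ... | yes _ = cong₂ _+_ (sym (+-identityʳ (f x))) (∑-filter P? xs f)
  ... | no _ = ∑-filter P? xs f

  length-filter : {P : A → Set} (P? : ∀ a → Dec (P a)) (xs : List A) →
    length (filter P? xs) ≡ ∑[ a ∈ xs ] ind (P? a)
  length-filter P? [] = refl
  length-filter P? (x ∷ xs) with P? x
  ... | yes _ = cong suc (length-filter P? xs)
  ... | no _ = length-filter P? xs

  filter-partition-↭ : {P : A → Set} (P? : ∀ a → Dec (P a)) (xs : List A) →
    xs ↭ filter P? xs ++ filter (λ a → ¬? (P? a)) xs
  filter-partition-↭ P? [] = ↭-refl
  filter-partition-↭ P? (x ∷ xs) with P? x
  ... | yes _ = prep x (filter-partition-↭ P? xs)
  ... | no _ = ↭-trans (prep x (filter-partition-↭ P? xs)) (↭-sym (shift x (filter P? xs) _))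

  ∑-unique : (xs : List A) → Unique xs → (c : A) → c ∈ₗ xs →
    (d : ∀ a → Dec (a ≡ c)) → ∑[ a ∈ xs ] ind (d a) ≡ 1
  ∑-unique (x ∷ xs) (x∉xs ∷ _) .x (here refl) d =
    cong₂ _+_ (ind-yes (d x) refl)
              (∑-zero xs _ (λ a m → ind-no (d a) (λ a≡x → All.lookup x∉xs m (sym a≡x))))
  ∑-unique (x ∷ xs) (x∉xs ∷ u) c (there m) d =
    cong₂ _+_ (ind-no (d x) (All.lookup x∉xs m)) (∑-unique xs u c m d)

  ∑-atMostOne : (xs : List A) → Unique xs → (∀ a → a ∈ₗ xs) →
    {P : A → Set} (d : ∀ a → Dec (P a)) → (∀ a b → P a → P b → a ≡ b) →
    (e : Dec (∃ P)) → ∑[ a ∈ xs ] ind (d a) ≡ ind e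
  ∑-atMostOne xs u complete {P} d atMostOne (yes (c , pc)) =
    trans (∑-cong xs (λ a → ind-⇔ (d a) (d≡c a) (λ pa → atMostOne a c pa pc) (λ { refl → pc })))
          (∑-unique xs u c (complete c) d≡c)
    where
    d≡c : ∀ a → Dec (a ≡ c)
    d≡c a with d a
    ... | yes pa = yes (atMostOne a c pa pc)
    ... | no ¬pa = no (λ { refl → ¬pa pc })
  ∑-atMostOne xs u complete d atMostOne (no ∄) =
    ∑-zero xs _ (λ a _ → ind-no (d a) (λ pa → ∄ (a , pa)))

  ∑-saturated : (xs : List A) (g : A → ℕ) → (∀ a → g a ≤ 1) →
    ∑ xs g ≡ length xs → ∀ a → a ∈ₗ xs → g a ≡ 1
  ∑-saturated (x ∷ xs) g g≤1 total a a∈ = go a∈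
    where
    ∑≤length : ∀ ys → ∑ ys g ≤ length ys
    ∑≤length [] = z≤n
    ∑≤length (y ∷ ys) = +-mono-≤ (g≤1 y) (∑≤length ys)
    head≡1 : g x ≡ 1
    head≡1 = ≤-antisym (g≤1 x) (+-cancelʳ-≤ (length xs) 1 (g x)
      (subst (_≤ g x + length xs) total (+-monoʳ-≤ (g x) (∑≤length xs))))
    tail≡length : ∑ xs g ≡ length xs
    tail≡length = +-cancelˡ-≡ 1 _ _ (trans (cong (_+ ∑ xs g) (sym head≡1)) total)
    go : a ∈ₗ (x ∷ xs) → g a ≡ 1
    go (here refl) = head≡1
    go (there m) = ∑-saturated xs g g≤1 tail≡length a m

  ∑-allFin-suc : ∀ {n} (f : Fin (suc n) → ℕ) →
    ∑ (allFin (suc n)) f ≡ f zero + ∑[ i ∈ allFin n ] f (suc i)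
  ∑-allFin-suc {n} f = cong (f zero +_)
    (trans (cong (λ l → ∑ l f) (sym (map-tabulate (λ i → i) suc))) (∑-map (allFin n) suc f))

  ∣∣≡∑∈ : ∀ {n} (p : Subset n) → ∣ p ∣ ≡ ∑[ h ∈ allFin n ] ind (h ∈? p)
  ∣∣≡∑∈ [] = refl
  ∣∣≡∑∈ {suc n} (b ∷ p) = trans (head+tail b) (sym (∑-allFin-suc (λ h → ind (h ∈? (b ∷ p)))))
    where
    tail≡ : ∀ b → ∑[ h ∈ allFin n ] ind (h ∈? p) ≡ ∑[ h ∈ allFin n ] ind (suc h ∈? (b ∷ p))
    tail≡ b = ∑-cong (allFin n) (λ h → ind-⇔ (h ∈? p) (suc h ∈? (b ∷ p)) Vec.there drop-there)
    head+tail : ∀ b → ∣ b ∷ p ∣ ≡ ind (zero ∈? (b ∷ p)) + ∑[ h ∈ allFin n ] ind (suc h ∈? (b ∷ p))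
    head+tail true = cong suc (trans (∣∣≡∑∈ p) (tail≡ true))
    head+tail false = trans (∣∣≡∑∈ p) (tail≡ false)

  ∑-allFin-1 : ∀ n → ∑[ _ ∈ allFin n ] 1 ≡ n
  ∑-allFin-1 n = trans (∑-1 (allFin n)) (length-tabulate (λ i → i))

  ∑-point : ∀ {n} (c : Fin n) → ∑[ a ∈ allFin n ] ind (a ≟ᶠ c) ≡ 1
  ∑-point {n} c = ∑-unique (allFin n) (allFin⁺ n) c (∈-allFin c) (_≟ᶠ c)

  ∑-evaluate : ∀ {n} (c : Fin n) (f : Fin n → ℕ) → ∑[ a ∈ allFin n ] (ind (a ≟ᶠ c) * f a) ≡ f c
  ∑-evaluate {n} c f = begin
    ∑[ a ∈ allFin n ] (ind (a ≟ᶠ c) * f a) ≡⟨ ∑-cong (allFin n) at-c ⟩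
    ∑[ a ∈ allFin n ] (ind (a ≟ᶠ c) * f c) ≡⟨ ∑-*ʳ (allFin n) (f c) _ ⟩
    ∑[ a ∈ allFin n ] ind (a ≟ᶠ c) * f c   ≡⟨ cong (_* f c) (∑-point c) ⟩
    1 * f c                                ≡⟨ *-identityˡ (f c) ⟩
    f c                                    ∎
    where
    open ≡-Reasoning
    at-c : ∀ a → ind (a ≟ᶠ c) * f a ≡ ind (a ≟ᶠ c) * f c
    at-c a with a ≟ᶠ c
    ... | yes refl = refl
    ... | no _ = refl

  ∑-all-but-one : ∀ {n} (c : Fin n) → ∑[ i ∈ allFin n ] ind (¬? (i ≟ᶠ c)) ≡ n ∸ 1
  ∑-all-but-one {n} c = trans (sym (m+n∸n≡m _ 1)) (cong (_∸ 1) (begin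
    ∑[ i ∈ allFin n ] ind (¬? (i ≟ᶠ c)) + 1
      ≡⟨ cong (∑[ i ∈ allFin n ] ind (¬? (i ≟ᶠ c)) +_) (sym (∑-point c)) ⟩
    ∑[ i ∈ allFin n ] ind (¬? (i ≟ᶠ c)) + ∑[ i ∈ allFin n ] ind (i ≟ᶠ c)
      ≡⟨ sym (∑-+ (allFin n) _ _) ⟩
    ∑[ i ∈ allFin n ] (ind (¬? (i ≟ᶠ c)) + ind (i ≟ᶠ c))
      ≡⟨ ∑-cong (allFin n) (λ i → ind-¬ (i ≟ᶠ c)) ⟩
    ∑[ i ∈ allFin n ] 1
      ≡⟨ ∑-allFin-1 n ⟩
    n ∎))
    where open ≡-Reasoning

  ∑-injective-fibre : ∀ {n} (f : Fin n → Fin n) → (∀ {a b} → f a ≡ f b → a ≡ b) →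
    ∀ x → ∑[ a ∈ allFin n ] ind (f a ≟ᶠ x) ≡ 1
  ∑-injective-fibre {n} f f-inj x = ∑-saturated (allFin n) fibre fibre≤1 total x (∈-allFin x)
    where
    fibre : Fin n → ℕ
    fibre x = ∑[ a ∈ allFin n ] ind (f a ≟ᶠ x)
    fibre≤1 : ∀ x → fibre x ≤ 1
    fibre≤1 x = subst (_≤ 1)
      (sym (∑-atMostOne (allFin n) (allFin⁺ n) ∈-allFin (λ a → f a ≟ᶠ x)
             (λ a b p q → f-inj (trans p (sym q))) (any? (λ a → f a ≟ᶠ x))))
      (ind≤1 _)
    total : ∑ (allFin n) fibre ≡ length (allFin n)
    total = begin
      ∑[ x ∈ allFin n ] ∑[ a ∈ allFin n ] ind (f a ≟ᶠ x) ≡⟨ ∑-swap (allFin n) (allFin n) _ ⟩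
      ∑[ a ∈ allFin n ] ∑[ x ∈ allFin n ] ind (f a ≟ᶠ x) ≡⟨ ∑-cong (allFin n) (λ a → trans
                                                              (∑-cong (allFin n) (λ x → ind-⇔ _ _ sym sym))
                                                              (∑-point (f a))) ⟩
      ∑[ a ∈ allFin n ] 1                                ≡⟨ ∑-1 (allFin n) ⟩
      length (allFin n)                                  ∎
      where open ≡-Reasoning

  ∑-involution : ∀ {n} (σ : Fin n → Fin n) → (∀ a → σ (σ a) ≡ a) → (f : Fin n → ℕ) →
    ∑[ a ∈ allFin n ] f (σ a) ≡ ∑ (allFin n) f
  ∑-involution {n} σ σσ f = begin
    ∑[ a ∈ allFin n ] f (σ a)                                   ≡⟨ ∑-cong (allFin n) (λ a → sym (∑-evaluate (σ a) f)) ⟩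
    ∑[ a ∈ allFin n ] ∑[ b ∈ allFin n ] (ind (b ≟ᶠ σ a) * f b)  ≡⟨ ∑-swap (allFin n) (allFin n) _ ⟩
    ∑[ b ∈ allFin n ] ∑[ a ∈ allFin n ] (ind (b ≟ᶠ σ a) * f b)  ≡⟨ ∑-cong (allFin n) (λ b → ∑-*ʳ (allFin n) (f b) _) ⟩
    ∑[ b ∈ allFin n ] (∑[ a ∈ allFin n ] ind (b ≟ᶠ σ a) * f b)  ≡⟨ ∑-cong (allFin n) (λ b → cong (_* f b) (one-preimage b)) ⟩
    ∑[ b ∈ allFin n ] (1 * f b)                                 ≡⟨ ∑-cong (allFin n) (λ b → *-identityˡ (f b)) ⟩
    ∑ (allFin n) f                                              ∎
    where
    open ≡-Reasoning
    one-preimage : ∀ b → ∑[ a ∈ allFin n ] ind (b ≟ᶠ σ a) ≡ 1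
    one-preimage b = trans (∑-cong (allFin n) (λ a → ind-⇔ _ (a ≟ᶠ σ b)
                             (λ e → trans (sym (σσ a)) (cong σ (sym e)))
                             (λ e → trans (sym (σσ b)) (cong σ (sym e)))))
                           (∑-point (σ b))

  Even : ℕ → Set
  Even n = ∃ λ m → n ≡ m + m

  -- A set carrying a fixed-point-free involution has even size: the pairs
  -- {a , σ a} are counted once each through their smaller element.
  involution-even : ∀ {n} (σ : Fin n → Fin n) → (∀ a → σ (σ a) ≡ a) → (∀ a → ¬ σ a ≡ a) →
    Even n
  involution-even {n} σ σσ no-fix = m , sym (begin
    m + m                                   ≡⟨ cong (m +_) (sym (∑-involution σ σσ smaller)) ⟩
    m + ∑[ a ∈ allFin n ] smaller (σ a)     ≡⟨ sym (∑-+ (allFin n) smaller (λ a → smaller (σ a))) ⟩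
    ∑[ a ∈ allFin n ] (smaller a + smaller (σ a)) ≡⟨ ∑-cong (allFin n) one-smaller ⟩
    ∑[ a ∈ allFin n ] 1                     ≡⟨ ∑-allFin-1 n ⟩
    n                                       ∎)
    where
    open ≡-Reasoning
    smaller : Fin n → ℕ
    smaller a = ind (a <? σ a)
    m : ℕ
    m = ∑ (allFin n) smaller
    one-smaller : ∀ a → smaller a + smaller (σ a) ≡ 1
    one-smaller a with <-cmp a (σ a)
    ... | tri< a<σa _ a≯σa = cong₂ _+_ (ind-yes (a <? σ a) a<σa)
            (ind-no (σ a <? σ (σ a)) (λ σa<a → a≯σa (subst (σ a <ᶠ_) (σσ a) σa<a)))
    ... | tri≈ _ a≡σa _ = ⊥-elim (no-fix a (sym a≡σa))
    ... | tri> a≮σa _ σa<a = cong₂ _+_ (ind-no (a <? σ a) a≮σa)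
            (ind-yes (σ a <? σ (σ a)) (subst (σ a <ᶠ_) (sym (σσ a)) σa<a))

  odd-product⇒odd-factors : ∀ v k → (v * k) % 2 ≡ 1 → ¬ Even v × ¬ Even k
  odd-product⇒odd-factors v k odd =
    (λ { (m , refl) → even*≢odd m k odd }) ,
    (λ { (m , refl) → even*≢odd m v (trans (cong (_% 2) (*-comm (m + m) v)) odd) })
    where
    even*≢odd : ∀ m k → ¬ ((m + m) * k) % 2 ≡ 1
    even*≢odd m k odd with trans (sym (m*n%n≡0 (m * k) 2))
                                (trans (cong (_% 2) (sym (double*≡*2 m k))) odd)
      where
      double*≡*2 : ∀ m k → (m + m) * k ≡ (m * k) * 2
      double*≡*2 = solve-∀
    ... | ()

  half : ∀ e n → e + e ≡ n → e ≡ n / 2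
  half e n e+e≡n = trans (sym (m*n/n≡m e 2)) (cong (_/ 2) (trans (*2≡double e) e+e≡n))
    where
    *2≡double : ∀ e → e * 2 ≡ e + e
    *2≡double = solve-∀

  ∑-split-half : (xs : List A) (f : A → ℕ) {Q : A → Set} (Q? : ∀ a → Dec (Q a)) (N : ℕ) →
    ∑ xs f ≡ N → ∑[ a ∈ xs ] (f a * ind (¬? (Q? a))) ≡ ∑[ a ∈ xs ] (f a * ind (Q? a)) →
    ∑[ a ∈ xs ] (f a * ind (Q? a)) ≡ N / 2
  ∑-split-half xs f Q? N total parts-equal = half _ N (begin
    ∑[ a ∈ xs ] (f a * ind (Q? a)) + ∑[ a ∈ xs ] (f a * ind (Q? a))
      ≡⟨ cong (∑[ a ∈ xs ] (f a * ind (Q? a)) +_) (sym parts-equal) ⟩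
    ∑[ a ∈ xs ] (f a * ind (Q? a)) + ∑[ a ∈ xs ] (f a * ind (¬? (Q? a)))
      ≡⟨ sym (∑-+ xs _ _) ⟩
    ∑[ a ∈ xs ] (f a * ind (Q? a) + f a * ind (¬? (Q? a)))
      ≡⟨ ∑-cong xs recombine ⟩
    ∑ xs f
      ≡⟨ total ⟩
    N ∎)
    where
    open ≡-Reasoning
    recombine : ∀ a → f a * ind (Q? a) + f a * ind (¬? (Q? a)) ≡ f a
    recombine a = begin
      f a * ind (Q? a) + f a * ind (¬? (Q? a)) ≡⟨ sym (*-distribˡ-+ (f a) _ _) ⟩
      f a * (ind (Q? a) + ind (¬? (Q? a)))     ≡⟨ cong (f a *_) (+-comm (ind (Q? a)) _) ⟩
      f a * (ind (¬? (Q? a)) + ind (Q? a))     ≡⟨ cong (f a *_) (ind-¬ (Q? a)) ⟩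
      f a * 1                                  ≡⟨ *-identityʳ (f a) ⟩
      f a ∎

open Counting

module _ (O : StrictTotalOrder 0ℓ 0ℓ 0ℓ) where
  open StrictTotalOrder O using (Carrier; _≈_; compare) renaming (_<_ to _≺_; _<?_ to _≺?_)

  <-exactly-one : ∀ {x y : Carrier} → ¬ x ≈ y → ind (¬? (y ≺? x)) ≡ ind (x ≺? y)
  <-exactly-one {x} {y} x≉y = by-cases (compare x y)
    where
    by-cases : Tri (x ≺ y) (x ≈ y) (y ≺ x) → ind (¬? (y ≺? x)) ≡ ind (x ≺? y)
    by-cases (tri< x<y _ y≮x) = trans (ind-yes (¬? (y ≺? x)) y≮x) (sym (ind-yes (x ≺? y) x<y))
    by-cases (tri≈ _ x≈y _) = ⊥-elim (x≉y x≈y)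
    by-cases (tri> x≮y _ y<x) = trans (ind-no (¬? (y ≺? x)) (λ y≮x → y≮x y<x)) (sym (ind-no (x ≺? y) x≮y))

SubsetOrder : ℕ → StrictTotalOrder 0ℓ 0ℓ 0ℓ
SubsetOrder = Lex.<-strictTotalOrder Bool.<-strictTotalOrder

asGroup : ∀ {v} → FinGroup v → Group 0ℓ 0ℓ
asGroup {v} G = record
  { Carrier = Fin v ; _≈_ = _≡_ ; _∙_ = _+_ ; ε = 0# ; _⁻¹ = -_
  ; isGroup = record
    { isMonoid = record
      { isSemigroup = record
        { isMagma = record { isEquivalence = isEquivalence ; ∙-cong = cong₂ _+_ }
        ; assoc = +-assoc }
      ; identity = +-idˡ , +-idʳ }
    ; inverse = -‿invˡ , -‿invʳ
    ; ⁻¹-cong = cong (-_) } }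
  where open FinGroup G

module GroupLaws {v} (G : FinGroup v) where
  open FinGroup G public
  open GroupProperties (asGroup G) public
    using (∙-cancelˡ; ∙-cancelʳ; identityʳ-unique; inverseˡ-unique; ε⁻¹≈ε; ⁻¹-involutive; ⁻¹-injective;
           ⁻¹-anti-homo-∙; \\-leftDividesˡ; \\-leftDividesʳ; //-rightDividesˡ; y≈x\\z)

  translate-fixed⇒0 : ∀ x a → a ≡ - x + a → x ≡ 0#
  translate-fixed⇒0 x a a≡-x+a = ⁻¹-injective (trans (sym (∙-cancelʳ a 0# (- x) (trans (+-idˡ a) a≡-x+a))) (sym ε⁻¹≈ε))

  difference⇒partner : ∀ x a b → a - b ≡ x → b ≡ - x + a
  difference⇒partner x a b a-b≡x = y≈x\\z x b a (trans (cong (_+ b) (sym a-b≡x)) (//-rightDividesˡ b a))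

  partner-difference : ∀ x a → a - (- x + a) ≡ x
  partner-difference x a = begin
    a + - (- x + a)     ≡⟨ cong (a +_) (⁻¹-anti-homo-∙ (- x) a) ⟩
    a + (- a + - (- x)) ≡⟨ \\-leftDividesˡ a (- (- x)) ⟩
    - (- x)             ≡⟨ ⁻¹-involutive x ⟩
    x                   ∎
    where open ≡-Reasoning

  -- A non-zero element y with y + y = 0 makes translation by y a fixed-point-free
  -- involution of G, so G has even order.
  order-two⇒even : ∀ y → ¬ y ≡ 0# → y + y ≡ 0# → Even v
  order-two⇒even y y≢0 y+y≡0 = involution-even (_+ y)
    (λ h → trans (+-assoc h y y) (trans (cong (h +_) y+y≡0) (+-idʳ h)))
    (λ h h+y≡h → y≢0 (∙-cancelˡ h y 0# (trans h+y≡h (sym (+-idʳ h)))))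

does-true⁻ : {P : Set} (d : Dec P) → does d ≡ true → P
does-true⁻ (yes p) _ = p

module _ {n : ℕ} {f : Fin n → Bool} {h : Fin n} where
  ∈tabulate⁻ : h ∈ Vec.tabulate f → f h ≡ true
  ∈tabulate⁻ h∈ = trans (sym (lookup∘tabulate f h)) ([]=⇒lookup h∈)

  ∈tabulate⁺ : f h ≡ true → h ∈ Vec.tabulate f
  ∈tabulate⁺ fh≡true = lookup⇒[]= h _ (trans (lookup∘tabulate f h) fh≡true)

module AutomorphismGroup {v k : ℕ} (G : FinGroup v) (α : Fin k → Fin v → Fin v)
                         (isAutGroup : IsAutGroup G k α) where
  open GroupLaws G
  open IsAutGroup isAutGroup

  α-hom : ∀ i x y → α i (x + y) ≡ α i x + α i y
  α-hom i = proj₁ (auto i)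

  α-injective : ∀ i {x y} → α i x ≡ α i y → x ≡ y
  α-injective i = proj₁ (proj₂ (auto i))

  α-0 : ∀ i → α i 0# ≡ 0#
  α-0 i = identityʳ-unique (α i 0#) (α i 0#) (trans (sym (α-hom i 0# 0#)) (cong (α i) (+-idˡ 0#)))

  α-neg : ∀ i g → α i (- g) ≡ - α i g
  α-neg i g = inverseˡ-unique (α i (- g)) (α i g)
    (trans (sym (α-hom i (- g) g)) (trans (cong (α i) (-‿invˡ g)) (α-0 i)))

  ι : Fin k
  ι = proj₁ hasId

  α-ι : ∀ g → α ι g ≡ g
  α-ι = proj₂ hasId

  infix 10 _⁻¹ᴬ
  infixr 9 _∘ᴬ_

  _⁻¹ᴬ : Fin k → Fin k
  i ⁻¹ᴬ = proj₁ (hasInv i)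

  α-inverse : ∀ i g → α (i ⁻¹ᴬ) (α i g) ≡ g
  α-inverse i = proj₂ (hasInv i)

  _∘ᴬ_ : Fin k → Fin k → Fin k
  i ∘ᴬ j = proj₁ (closed i j)

  α-∘ : ∀ i j g → α (i ∘ᴬ j) g ≡ α i (α j g)
  α-∘ i j = proj₂ (closed i j)

  identity-is-ι : ∀ i → (∀ g → α i g ≡ g) → i ≡ ι
  identity-is-ι i α-i-id = distinct i ι (λ g → trans (α-i-id g) (sym (α-ι g)))

  -- A non-identity involution i in A makes j ↦ j ∘ i a fixed-point-free
  -- involution of A, so A has even order.
  involution⇒even : ∀ i → ¬ (∀ g → α i g ≡ g) → (∀ g → α i (α i g) ≡ g) → Even k
  involution⇒even i i≢id i∘i≡id = involution-even (_∘ᴬ i)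
    (λ j → distinct _ _ (λ g → trans (α-∘ _ i g) (trans (α-∘ j i _) (cong (α j) (i∘i≡id g)))))
    (λ j j∘i≡j → i≢id (λ g → α-injective j (trans (sym (α-∘ j i g)) (cong (λ l → α l g) j∘i≡j))))

module FerreroPair {v k : ℕ} (G : FinGroup v) (α : Fin k → Fin v → Fin v)
                   (ferrero : IsFerreroPair G k α) where
  open GroupLaws G
  open IsAutGroup (proj₁ ferrero)
  open AutomorphismGroup G α (proj₁ ferrero)

  semiregular : ∀ i g → α i g ≡ g → (∀ h → α i h ≡ h) ⊎ g ≡ 0#
  semiregular = proj₂ (proj₂ ferrero)

  α-regular : ∀ g → ¬ g ≡ 0# → ∀ i j → α i g ≡ α j g → i ≡ j
  α-regular g g≢0 i j αig≡αjg with semiregular (j ⁻¹ᴬ ∘ᴬ i) g fixes-g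
    where
    fixes-g : α (j ⁻¹ᴬ ∘ᴬ i) g ≡ g
    fixes-g = trans (α-∘ _ _ g) (trans (cong (α (j ⁻¹ᴬ)) αig≡αjg) (α-inverse j g))
  ... | inj₂ g≡0 = ⊥-elim (g≢0 g≡0)
  ... | inj₁ identity = distinct i j (λ h → α-injective (j ⁻¹ᴬ)
          (trans (sym (α-∘ _ _ h)) (trans (identity h) (sym (α-inverse j h)))))

  O : Fin v → Subset v
  O = orbit G α

  ∈O⁻ : ∀ {g h} → h ∈ O g → ∃ λ i → α i g ≡ h
  ∈O⁻ {g} {h} h∈ = does-true⁻ (any? (λ i → α i g ≟ᶠ h)) (∈tabulate⁻ h∈)

  ∈O⁺ : ∀ {g h} i → α i g ≡ h → h ∈ O g
  ∈O⁺ {g} {h} i αig≡h = ∈tabulate⁺ (dec-true (any? (λ i → α i g ≟ᶠ h)) (i , αig≡h))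

  O-refl : ∀ g → g ∈ O g
  O-refl g = ∈O⁺ ι (α-ι g)

  O-sym : ∀ {g h} → h ∈ O g → g ∈ O h
  O-sym h∈ with ∈O⁻ h∈
  ... | i , refl = ∈O⁺ (i ⁻¹ᴬ) (α-inverse i _)

  O-trans : ∀ {g h l} → h ∈ O g → l ∈ O h → l ∈ O g
  O-trans h∈ l∈ with ∈O⁻ h∈ | ∈O⁻ l∈
  ... | i , refl | j , refl = ∈O⁺ (j ∘ᴬ i) (α-∘ j i _)

  O-≡ : ∀ {g h} → h ∈ O g → O h ≡ O g
  O-≡ h∈ = ⊆-antisym (λ l∈ → O-trans h∈ l∈) (λ l∈ → O-trans (O-sym h∈) l∈)

  O-nonzero : ∀ {g h} → ¬ g ≡ 0# → h ∈ O g → ¬ h ≡ 0#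
  O-nonzero g≢0 h∈ h≡0 with ∈O⁻ h∈
  ... | i , αig≡h = g≢0 (α-injective i (trans αig≡h (trans h≡0 (sym (α-0 i)))))

  O-0 : ∀ {h} → h ∈ O 0# → h ≡ 0#
  O-0 h∈ with ∈O⁻ h∈
  ... | i , αi0≡h = trans (sym αi0≡h) (α-0 i)

  O-neg : ∀ {g h} → h ∈ O g → (- h) ∈ O (- g)
  O-neg h∈ with ∈O⁻ h∈
  ... | i , refl = ∈O⁺ i (α-neg i _)

  O-size : ∀ g → ¬ g ≡ 0# → ∣ O g ∣ ≡ k
  O-size g g≢0 = begin
    ∣ O g ∣                                            ≡⟨ ∣∣≡∑∈ (O g) ⟩
    ∑[ h ∈ allFin v ] ind (h ∈? O g)                   ≡⟨ ∑-cong (allFin v) (λ h → ind-⇔ _ _ ∈O⁻ (λ (i , e) → ∈O⁺ i e)) ⟩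
    ∑[ h ∈ allFin v ] ind (any? (λ i → α i g ≟ᶠ h))    ≡⟨ ∑-cong (allFin v) (λ h → sym (images-of-g h)) ⟩
    ∑[ h ∈ allFin v ] ∑[ i ∈ allFin k ] ind (α i g ≟ᶠ h) ≡⟨ ∑-swap (allFin v) (allFin k) _ ⟩
    ∑[ i ∈ allFin k ] ∑[ h ∈ allFin v ] ind (α i g ≟ᶠ h) ≡⟨ ∑-cong (allFin k) (λ i → trans
                                                             (∑-cong (allFin v) (λ h → ind-⇔ _ _ sym sym))
                                                             (∑-point (α i g))) ⟩
    ∑[ i ∈ allFin k ] 1                                ≡⟨ ∑-allFin-1 k ⟩
    k                                                  ∎
    where
    open ≡-Reasoning
    images-of-g : ∀ h → ∑[ i ∈ allFin k ] ind (α i g ≟ᶠ h) ≡ ind (any? (λ i → α i g ≟ᶠ h))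
    images-of-g h = ∑-atMostOne (allFin k) (allFin⁺ k) ∈-allFin (λ i → α i g ≟ᶠ h)
      (λ i j αig≡h αjg≡h → α-regular g g≢0 i j (trans αig≡h (sym αjg≡h))) _

  Os : List (Subset v)
  Os = orbits G α

  IsNonzeroOrbit : Subset v → Set
  IsNonzeroOrbit B = ∃ λ g → ¬ g ≡ 0# × B ≡ O g

  ∈Os⁻ : ∀ {B} → B ∈ₗ Os → IsNonzeroOrbit B
  ∈Os⁻ B∈ with ∈-map⁻ O (∈-deduplicate⁻ (≡-dec _≟ᵇ_) _ B∈)
  ... | g , g∈ , B≡Og = g , proj₂ (∈-filter⁻ (λ g → ¬? (g ≟ᶠ 0#)) {xs = allFin v} g∈) , B≡Og

  ∈Os⁺ : ∀ {g} → ¬ g ≡ 0# → O g ∈ₗ Os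
  ∈Os⁺ {g} g≢0 = ∈-deduplicate⁺ (≡-dec _≟ᵇ_) (∈-map⁺ O (∈-filter⁺ (λ g → ¬? (g ≟ᶠ 0#)) (∈-allFin g) g≢0))

  Os-unique : Unique Os
  Os-unique = deduplicate-! (≡-dec _≟ᵇ_) _

  Os-sizes : All (λ B → ∣ B ∣ ≡ k) Os
  Os-sizes = All.tabulate λ B∈ → let (g , g≢0 , B≡Og) = ∈Os⁻ B∈ in trans (cong ∣_∣ B≡Og) (O-size g g≢0)

  orbits-disjoint : ∀ g h → ¬ O g ≡ O h → O g ∩ O h ≡ ⊥
  orbits-disjoint g h Og≢Oh = Empty-unique λ (l , l∈) →
    let (l∈Og , l∈Oh) = x∈p∩q⁻ (O g) (O h) l∈ in Og≢Oh (trans (sym (O-≡ l∈Og)) (O-≡ l∈Oh))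

  Os-disjoint : AllPairs (λ B C → B ∩ C ≡ ⊥) Os
  Os-disjoint = distinct⇒disjoint (All.tabulate ∈Os⁻) Os-unique
    where
    distinct⇒disjoint : ∀ {Bs} → All IsNonzeroOrbit Bs → AllPairs (λ B C → ¬ B ≡ C) Bs →
                        AllPairs (λ B C → B ∩ C ≡ ⊥) Bs
    distinct⇒disjoint [] [] = []
    distinct⇒disjoint ((g , _ , refl) ∷ orbs) (B≢Cs ∷ distinct) =
      All.zipWith (λ { ((h , _ , refl) , Og≢Oh) → orbits-disjoint g h Og≢Oh }) (orbs , B≢Cs)
      ∷ distinct⇒disjoint orbs distinct

  _≟ₛ_ : (B C : Subset v) → Dec (B ≡ C)
  _≟ₛ_ = ≡-dec _≟ᵇ_

  inBlock? : (B : Subset v) (a b : Fin v) → Dec (a ∈ B × b ∈ B)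
  inBlock? B a b = (a ∈? B) ×-dec (b ∈? B)

  difference? : (x a b : Fin v) → Dec (¬ a ≡ b × a - b ≡ x)
  difference? x a b = ¬? (a ≟ᶠ b) ×-dec ((a - b) ≟ᶠ x)

  ΔCount-as-∑ : ∀ B x → ΔCount G B x ≡
    ∑[ a ∈ allFin v ] ∑[ b ∈ allFin v ] (ind (inBlock? B a b) * ind (difference? x a b))
  ΔCount-as-∑ B x =
    trans (length-filter (λ (a , b) → inBlock? B a b ×-dec difference? x a b) (cartesianProduct (allFin v) (allFin v)))
    (trans (∑-cartesianProduct (allFin v) (allFin v) _)
           (∑-cong (allFin v) (λ a → ∑-cong (allFin v) (λ b → ind-× (inBlock? B a b) (difference? x a b)))))

  commonOrbit? : (a b : Fin v) → Dec (¬ a ≡ 0# × b ∈ O a)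
  commonOrbit? a b = ¬? (a ≟ᶠ 0#) ×-dec (b ∈? O a)

  partner? : (x a : Fin v) → Dec ((- x + a) ∈ O a)
  partner? x a = (- x + a) ∈? O a

  partner⇒nonzero : ∀ {x a} → ¬ x ≡ 0# → (- x + a) ∈ O a → ¬ a ≡ 0#
  partner⇒nonzero {x} x≢0 partner∈ refl = x≢0 (translate-fixed⇒0 x 0# (sym (O-0 partner∈)))

  inBlock⇔ : ∀ {B} → B ∈ₗ Os → ∀ a b → ind (inBlock? B a b) ≡ ind (B ≟ₛ O a) * ind (commonOrbit? a b)
  inBlock⇔ {B} B∈ a b = trans (ind-⇔ (inBlock? B a b) ((B ≟ₛ O a) ×-dec commonOrbit? a b) to from)
                              (ind-× (B ≟ₛ O a) (commonOrbit? a b))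
    where
    to : a ∈ B × b ∈ B → B ≡ O a × ¬ a ≡ 0# × b ∈ O a
    to (a∈B , b∈B) with ∈Os⁻ B∈
    ... | g , g≢0 , refl = sym (O-≡ a∈B) , O-nonzero g≢0 a∈B , subst (b ∈_) (sym (O-≡ a∈B)) b∈B
    from : B ≡ O a × ¬ a ≡ 0# × b ∈ O a → a ∈ B × b ∈ B
    from (refl , _ , b∈Oa) = O-refl a , b∈Oa

  blocks-containing : ∀ (w : Subset v → ℕ) a b →
    ∑[ B ∈ Os ] (w B * ind (inBlock? B a b)) ≡ ind (commonOrbit? a b) * w (O a)
  blocks-containing w a b = begin
    ∑[ B ∈ Os ] (w B * ind (inBlock? B a b))       ≡⟨ ∑-congᵐ Os (λ B B∈ → trans (cong (w B *_) (inBlock⇔ B∈ a b))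
                                                                                 (only-O-a B)) ⟩
    ∑[ B ∈ Os ] (ind (B ≟ₛ O a) * c)               ≡⟨ ∑-*ʳ Os c _ ⟩
    ∑[ B ∈ Os ] ind (B ≟ₛ O a) * c                 ≡⟨ O-a-once (a ≟ᶠ 0#) ⟩
    c                                              ∎
    where
    open ≡-Reasoning
    c : ℕ
    c = ind (commonOrbit? a b) * w (O a)
    only-O-a : ∀ B → w B * (ind (B ≟ₛ O a) * ind (commonOrbit? a b)) ≡ ind (B ≟ₛ O a) * c
    only-O-a B with B ≟ₛ O a
    ... | yes refl = trans (cong (w B *_) (*-identityˡ _)) (trans (*-comm (w B) _) (sym (*-identityˡ _)))
    ... | no _ = *-zeroʳ (w B)
    O-a-once : Dec (a ≡ 0#) → ∑[ B ∈ Os ] ind (B ≟ₛ O a) * c ≡ c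
    O-a-once (yes a≡0) = trans (cong (∑[ B ∈ Os ] ind (B ≟ₛ O a) *_) c≡0) (trans (*-zeroʳ (∑[ B ∈ Os ] ind (B ≟ₛ O a))) (sym c≡0))
      where
      c≡0 : c ≡ 0
      c≡0 = cong (_* w (O a)) (ind-no (commonOrbit? a b) (λ (a≢0 , _) → a≢0 a≡0))
    O-a-once (no a≢0) = trans (cong (_* c) (∑-unique Os Os-unique (O a) (∈Os⁺ a≢0) (_≟ₛ O a))) (*-identityˡ c)

  difference-in-orbit : ∀ x → ¬ x ≡ 0# → ∀ a b →
    ind (commonOrbit? a b) * ind (difference? x a b) ≡ ind (b ≟ᶠ (- x + a)) * ind (partner? x a)
  difference-in-orbit x x≢0 a b =
    trans (sym (ind-× (commonOrbit? a b) (difference? x a b)))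
    (trans (ind-⇔ (commonOrbit? a b ×-dec difference? x a b) ((b ≟ᶠ (- x + a)) ×-dec partner? x a) to from)
           (ind-× (b ≟ᶠ (- x + a)) (partner? x a)))
    where
    to : (¬ a ≡ 0# × b ∈ O a) × (¬ a ≡ b × a - b ≡ x) → b ≡ - x + a × (- x + a) ∈ O a
    to ((_ , b∈Oa) , (_ , a-b≡x)) = b≡partner , subst (_∈ O a) b≡partner b∈Oa
      where
      b≡partner : b ≡ - x + a
      b≡partner = difference⇒partner x a b a-b≡x
    from : b ≡ - x + a × (- x + a) ∈ O a → (¬ a ≡ 0# × b ∈ O a) × (¬ a ≡ b × a - b ≡ x)
    from (refl , partner∈) =
      (partner⇒nonzero x≢0 partner∈ , partner∈) , (λ a≡b → x≢0 (translate-fixed⇒0 x a a≡b)) ,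
      partner-difference x a

  weighted-Δ : ∀ (w : Subset v → ℕ) x → ¬ x ≡ 0# →
    ∑[ B ∈ Os ] (w B * ΔCount G B x) ≡ ∑[ a ∈ allFin v ] (ind (partner? x a) * w (O a))
  weighted-Δ w x x≢0 = begin
    ∑[ B ∈ Os ] (w B * ΔCount G B x)
      ≡⟨ ∑-cong Os (λ B → trans (cong (w B *_) (ΔCount-as-∑ B x)) (distribute B)) ⟩
    ∑[ B ∈ Os ] ∑[ a ∈ allFin v ] ∑[ b ∈ allFin v ] (w B * (ind (inBlock? B a b) * ind (difference? x a b)))
      ≡⟨ ∑-swap Os (allFin v) _ ⟩
    ∑[ a ∈ allFin v ] ∑[ B ∈ Os ] ∑[ b ∈ allFin v ] (w B * (ind (inBlock? B a b) * ind (difference? x a b)))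
      ≡⟨ ∑-cong (allFin v) (λ a → ∑-swap Os (allFin v) _) ⟩
    ∑[ a ∈ allFin v ] ∑[ b ∈ allFin v ] ∑[ B ∈ Os ] (w B * (ind (inBlock? B a b) * ind (difference? x a b)))
      ≡⟨ ∑-cong (allFin v) (λ a → ∑-cong (allFin v) (λ b → pair-weight a b)) ⟩
    ∑[ a ∈ allFin v ] ∑[ b ∈ allFin v ] (ind (b ≟ᶠ (- x + a)) * (ind (partner? x a) * w (O a)))
      ≡⟨ ∑-cong (allFin v) (λ a → ∑-evaluate (- x + a) (λ _ → ind (partner? x a) * w (O a))) ⟩
    ∑[ a ∈ allFin v ] (ind (partner? x a) * w (O a)) ∎
    where
    open ≡-Reasoning
    distribute : ∀ B {t : Fin v → Fin v → ℕ} →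
      w B * ∑[ a ∈ allFin v ] ∑[ b ∈ allFin v ] t a b ≡ ∑[ a ∈ allFin v ] ∑[ b ∈ allFin v ] (w B * t a b)
    distribute B = trans (sym (∑-*ˡ (allFin v) (w B) _)) (∑-cong (allFin v) (λ a → sym (∑-*ˡ (allFin v) (w B) _)))
    pair-weight : ∀ a b →
      ∑[ B ∈ Os ] (w B * (ind (inBlock? B a b) * ind (difference? x a b)))
        ≡ ind (b ≟ᶠ (- x + a)) * (ind (partner? x a) * w (O a))
    pair-weight a b = begin
      ∑[ B ∈ Os ] (w B * (ind (inBlock? B a b) * ind (difference? x a b)))
        ≡⟨ ∑-cong Os (λ B → sym (*-assoc (w B) _ _)) ⟩
      ∑[ B ∈ Os ] (w B * ind (inBlock? B a b) * ind (difference? x a b))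
        ≡⟨ ∑-*ʳ Os _ _ ⟩
      ∑[ B ∈ Os ] (w B * ind (inBlock? B a b)) * ind (difference? x a b)
        ≡⟨ cong (_* ind (difference? x a b)) (blocks-containing w a b) ⟩
      ind (commonOrbit? a b) * w (O a) * ind (difference? x a b)
        ≡⟨ xy∙z≈xz∙y (ind (commonOrbit? a b)) (w (O a)) _ ⟩
      ind (commonOrbit? a b) * ind (difference? x a b) * w (O a)
        ≡⟨ cong (_* w (O a)) (difference-in-orbit x x≢0 a b) ⟩
      ind (b ≟ᶠ (- x + a)) * ind (partner? x a) * w (O a)
        ≡⟨ *-assoc (ind (b ≟ᶠ (- x + a))) _ _ ⟩
      ind (b ≟ᶠ (- x + a)) * (ind (partner? x a) * w (O a)) ∎

  -- For a non-identity automorphism α i, the displacement a ↦ a - α i a is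
  -- injective: if two displacements agree then α i fixes - b + a, which by
  -- semiregularity must be 0.
  displacement-injective : ∀ i → ¬ i ≡ ι → ∀ {a b} → a - α i a ≡ b - α i b → a ≡ b
  displacement-injective i i≢ι {a} {b} same with semiregular i (- b + a) fixes-quotient
    where
    quotient≡ : - b + a ≡ - α i b + α i a
    quotient≡ = begin
      - b + a                       ≡⟨ cong (- b +_) (sym (//-rightDividesˡ (α i a) a)) ⟩
      - b + ((a - α i a) + α i a)   ≡⟨ cong (λ t → - b + (t + α i a)) same ⟩
      - b + ((b - α i b) + α i a)   ≡⟨ cong (- b +_) (+-assoc b (- α i b) (α i a)) ⟩
      - b + (b + (- α i b + α i a)) ≡⟨ \\-leftDividesʳ b _ ⟩
      - α i b + α i a               ∎
      where open ≡-Reasoning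
    fixes-quotient : α i (- b + a) ≡ - b + a
    fixes-quotient = trans (α-hom i (- b) a) (trans (cong (_+ α i a) (α-neg i b)) (sym quotient≡))
  ... | inj₁ α-i-id = ⊥-elim (i≢ι (identity-is-ι i α-i-id))
  ... | inj₂ quotient≡0 = trans (sym (\\-leftDividesˡ b a)) (trans (cong (b +_) quotient≡0) (+-idʳ b))

  -- The equation α i a = - x + a (x ≠ 0) has no solution a for i = ι and
  -- exactly one otherwise: it says that the displacement of a is x.
  solutions : ∀ x → ¬ x ≡ 0# → ∀ i → ∑[ a ∈ allFin v ] ind (α i a ≟ᶠ (- x + a)) ≡ ind (¬? (i ≟ᶠ ι))
  solutions x x≢0 i with i ≟ᶠ ι
  ... | yes refl = ∑-zero (allFin v) _ (λ a _ → ind-no _ (λ e → x≢0 (translate-fixed⇒0 x a (trans (sym (α-ι a)) e))))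
  ... | no i≢ι = trans (∑-cong (allFin v) (λ a → ind-⇔ _ (displacement a ≟ᶠ x) (to a) (from a)))
                       (∑-injective-fibre displacement (displacement-injective i i≢ι) x)
    where
    displacement : Fin v → Fin v
    displacement a = a - α i a
    to : ∀ a → α i a ≡ - x + a → displacement a ≡ x
    to a αia≡partner = trans (cong (λ b → a - b) αia≡partner) (partner-difference x a)
    from : ∀ a → displacement a ≡ x → α i a ≡ - x + a
    from a = difference⇒partner x a (α i a)

  -- Exactly k - 1 elements have their x-partner in their own orbit (x ≠ 0):
  -- one for each non-identity element of A.
  partner-count : ∀ x → ¬ x ≡ 0# → ∑[ a ∈ allFin v ] ind (partner? x a) ≡ k ∸ 1
  partner-count x x≢0 = begin
    ∑[ a ∈ allFin v ] ind (partner? x a)                              ≡⟨ ∑-cong (allFin v) witnesses ⟩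
    ∑[ a ∈ allFin v ] ∑[ i ∈ allFin k ] ind (α i a ≟ᶠ (- x + a))      ≡⟨ ∑-swap (allFin v) (allFin k) _ ⟩
    ∑[ i ∈ allFin k ] ∑[ a ∈ allFin v ] ind (α i a ≟ᶠ (- x + a))      ≡⟨ ∑-cong (allFin k) (solutions x x≢0) ⟩
    ∑[ i ∈ allFin k ] ind (¬? (i ≟ᶠ ι))                              ≡⟨ ∑-all-but-one ι ⟩
    k ∸ 1                                                            ∎
    where
    open ≡-Reasoning
    -- by regularity at most one automorphism maps a to its partner
    witnesses : ∀ a → ind (partner? x a) ≡ ∑[ i ∈ allFin k ] ind (α i a ≟ᶠ (- x + a))
    witnesses a = trans (ind-⇔ _ (any? (λ i → α i a ≟ᶠ (- x + a))) ∈O⁻ (λ (i , e) → ∈O⁺ i e))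
      (sym (∑-atMostOne (allFin k) (allFin⁺ k) ∈-allFin (λ i → α i a ≟ᶠ (- x + a))
             (λ i j αia≡ αja≡ → α-regular a (partner⇒nonzero x≢0 (∈O⁺ i αia≡)) i j (trans αia≡ (sym αja≡))) _))

  orbits-DDF : IsDDF G Os k (k ∸ 1)
  orbits-DDF = (Os-sizes , index) , Os-disjoint
    where
    index : ∀ x → ¬ x ≡ 0# → sum (map (λ B → ΔCount G B x) Os) ≡ k ∸ 1
    index x x≢0 = begin
      sum (map (λ B → ΔCount G B x) Os)                     ≡⟨ sum-map Os _ ⟩
      ∑[ B ∈ Os ] ΔCount G B x                              ≡⟨ ∑-cong Os (λ B → sym (*-identityˡ _)) ⟩
      ∑[ B ∈ Os ] (1 * ΔCount G B x)                        ≡⟨ weighted-Δ (λ _ → 1) x x≢0 ⟩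
      ∑[ a ∈ allFin v ] (ind (partner? x a) * 1)            ≡⟨ ∑-cong (allFin v) (λ a → *-identityʳ _) ⟩
      ∑[ a ∈ allFin v ] ind (partner? x a)                  ≡⟨ partner-count x x≢0 ⟩
      k ∸ 1                                                 ∎
      where open ≡-Reasoning

  selection-DDF : {Q : Subset v → Set} (Q? : ∀ B → Dec (Q B)) (λ' : ℕ) →
    (∀ x → ¬ x ≡ 0# → ∑[ a ∈ allFin v ] (ind (partner? x a) * ind (Q? (O a))) ≡ λ') →
    IsDDF G (filter Q? Os) k λ'
  selection-DDF Q? λ' weighted-count =
    (All.filter⁺ Q? Os-sizes , index) , AllPairs.filter⁺ Q? Os-disjoint
    where
    index : ∀ x → ¬ x ≡ 0# → sum (map (λ B → ΔCount G B x) (filter Q? Os)) ≡ λ'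
    index x x≢0 = trans (sum-map (filter Q? Os) _) (trans (∑-filter Q? Os _)
                    (trans (weighted-Δ (λ B → ind (Q? B)) x x≢0) (weighted-count x x≢0)))

  neg : Subset v → Subset v
  neg B = Vec.tabulate (λ h → Vec.lookup B (- h))

  neg-orbit : ∀ g → neg (O g) ≡ O (- g)
  neg-orbit g = ⊆-antisym
    (λ {h} h∈ → subst (_∈ O (- g)) (⁻¹-involutive h) (O-neg (lookup⇒[]= (- h) (O g) (∈tabulate⁻ h∈))))
    (λ {h} h∈ → ∈tabulate⁺ ([]=⇒lookup (subst (λ l → (- h) ∈ O l) (⁻¹-involutive g) (O-neg h∈))))

module AbelianOddOrder {v k : ℕ} (G : FinGroup v) (α : Fin k → Fin v → Fin v)
                       (ferrero : IsFerreroPair G k α)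
                       (abelian : IsAbelian G) (odd : (v * k) % 2 ≡ 1) where
  open GroupLaws G
  open AutomorphismGroup G α (proj₁ ferrero)
  open FerreroPair G α ferrero
  open StrictTotalOrder (SubsetOrder v) using () renaming (_<_ to _≺_; _<?_ to _≺?_)

  -- Since v and k are odd, no orbit is its own negative: otherwise some α i
  -- maps y ≠ 0 to - y, so α i is an involution, and either α i is the
  -- identity, making y an element of order 2 in G, or it has order 2 in A.
  orbit≢neg-orbit : ∀ y → ¬ y ≡ 0# → ¬ O y ≡ O (- y)
  orbit≢neg-orbit y y≢0 Oy≡O-y with ∈O⁻ (subst (- y ∈_) (sym Oy≡O-y) (O-refl (- y)))
  ... | i , αiy≡-y with semiregular (i ∘ᴬ i) y twice-fixes-y
    where
    twice-fixes-y : α (i ∘ᴬ i) y ≡ y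
    twice-fixes-y = trans (α-∘ i i y) (trans (cong (α i) αiy≡-y)
                      (trans (α-neg i y) (trans (cong -_ αiy≡-y) (⁻¹-involutive y))))
  ... | inj₂ y≡0 = y≢0 y≡0
  ... | inj₁ twice-id with i ≟ᶠ ι
  ...   | yes refl = proj₁ (odd-product⇒odd-factors v k odd)
                       (order-two⇒even y y≢0 (trans (cong (y +_) (trans (sym (α-ι y)) αiy≡-y)) (-‿invʳ y)))
  ...   | no i≢ι = proj₂ (odd-product⇒odd-factors v k odd)
                     (involution⇒even i (λ α-i-id → i≢ι (identity-is-ι i α-i-id))
                                        (λ h → trans (sym (α-∘ i i h)) (twice-id h)))

  selected? : (B : Subset v) → Dec (B ≺ neg B)
  selected? B = B ≺? neg B

  selection-flips : ∀ y → ¬ y ≡ 0# → ind (¬? (selected? (O (- y)))) ≡ ind (selected? (O y))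
  selection-flips y y≢0 = begin
    ind (¬? (O (- y) ≺? neg (O (- y)))) ≡⟨ cong (λ C → ind (¬? (O (- y) ≺? C))) (trans (neg-orbit (- y)) (cong O (⁻¹-involutive y))) ⟩
    ind (¬? (O (- y) ≺? O y))           ≡⟨ <-exactly-one (SubsetOrder v) (λ same → orbit≢neg-orbit y y≢0 (Pointwise-≡⇒≡ same)) ⟩
    ind (O y ≺? O (- y))                ≡⟨ cong (λ C → ind (O y ≺? C)) (sym (neg-orbit y)) ⟩
    ind (O y ≺? neg (O y))              ∎
    where open ≡-Reasoning

  module _ (x : Fin v) (x≢0 : ¬ x ≡ 0#) where
    reflect : Fin v → Fin v
    reflect d = x - d

    reflect-neg : ∀ d → reflect d ≡ - (- x + d)
    reflect-neg d = sym (trans (⁻¹-anti-homo-∙ (- x) d) (trans (cong (- d +_) (⁻¹-involutive x)) (abelian (- d) x)))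

    reflect-involutive : ∀ d → reflect (reflect d) ≡ d
    reflect-involutive d = begin
      x - (x - d)   ≡⟨ cong (x +_) (trans (cong (-_) (reflect-neg d)) (⁻¹-involutive (- x + d))) ⟩
      x + (- x + d) ≡⟨ \\-leftDividesˡ x d ⟩
      d             ∎
      where open ≡-Reasoning

    reflect-partner : ∀ d → (- x + d) ∈ O d → (- x + reflect d) ∈ O (reflect d)
    reflect-partner d partner∈ =
      subst₂ (λ p q → p ∈ O q) (sym (\\-leftDividesʳ x (- d))) (sym (reflect-neg d)) (O-neg (O-sym partner∈))

    reflect-weight : ∀ d →
      ind (partner? x (reflect d)) * ind (¬? (selected? (O (reflect d)))) ≡ ind (partner? x d) * ind (selected? (O d))
    reflect-weight d with partner? x d
    ... | no no-partner = cong (_* ind (¬? (selected? (O (reflect d))))) (ind-no (partner? x (reflect d)) (λ partner∈ → no-partner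
            (subst (λ q → (- x + q) ∈ O q) (reflect-involutive d) (reflect-partner (reflect d) partner∈))))
    ... | yes partner∈ = cong₂ _*_ (ind-yes (partner? x (reflect d)) (reflect-partner d partner∈)) (begin
      ind (¬? (selected? (O (reflect d))))      ≡⟨ cong (λ q → ind (¬? (selected? (O q)))) (reflect-neg d) ⟩
      ind (¬? (selected? (O (- (- x + d)))))    ≡⟨ selection-flips (- x + d) (O-nonzero (partner⇒nonzero x≢0 partner∈) partner∈) ⟩
      ind (selected? (O (- x + d)))             ≡⟨ cong (λ B → ind (selected? B)) (O-≡ partner∈) ⟩
      ind (selected? (O d))                     ∎)
      where open ≡-Reasoning

    halves-equal : ∑[ a ∈ allFin v ] (ind (partner? x a) * ind (¬? (selected? (O a))))
                 ≡ ∑[ a ∈ allFin v ] (ind (partner? x a) * ind (selected? (O a)))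
    halves-equal = trans (sym (∑-involution reflect reflect-involutive _)) (∑-cong (allFin v) reflect-weight)

    selected-half : ∑[ a ∈ allFin v ] (ind (partner? x a) * ind (selected? (O a))) ≡ (k ∸ 1) / 2
    selected-half = ∑-split-half (allFin v) (λ a → ind (partner? x a)) (λ a → selected? (O a)) (k ∸ 1)
                                 (partner-count x x≢0) halves-equal

  F₁ F₂ : List (Subset v)
  F₁ = filter selected? Os
  F₂ = filter (λ B → ¬? (selected? B)) Os

  Os↭F₁++F₂ : Os ↭ F₁ ++ F₂
  Os↭F₁++F₂ = filter-partition-↭ selected? Os

  F₁-DDF : IsDDF G F₁ k ((k ∸ 1) / 2)
  F₁-DDF = selection-DDF selected? _ selected-half

  F₂-DDF : IsDDF G F₂ k ((k ∸ 1) / 2)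
  F₂-DDF = selection-DDF (λ B → ¬? (selected? B)) _ (λ x x≢0 → trans (halves-equal x x≢0) (selected-half x x≢0))

theorem1 : (v k : ℕ) (G : FinGroup v) (α : Fin k → Fin v → Fin v) →
    IsFerreroPair G k α →
    IsDDF G (orbits G α) k (k ∸ 1) ×
    (IsAbelian G → (v * k) % 2 ≡ 1 →
      Σ (List (Subset v)) λ F₁ → Σ (List (Subset v)) λ F₂ →
        (orbits G α ↭ F₁ ++ F₂) ×
        IsDDF G F₁ k ((k ∸ 1) / 2) × IsDDF G F₂ k ((k ∸ 1) / 2))
theorem1 v k G α ferrero =
  FerreroPair.orbits-DDF G α ferrero ,
  λ abelian odd → let open AbelianOddOrder G α ferrero abelian odd in
    F₁ , F₂ , Os↭F₁++F₂ , F₁-DDF , F₂-DDF
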